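{- Let $n$ be a positive integer and let $D_n$ be a maximal Diophantine graph of order $n$. Let $p_1,\dots,p_r$ be the distinct prime numbers $p$ satisfying $p^{\acute{v}_{p}(n)}<\frac{n}{2}$. Then the number of full degree vertices of $D_n$ is $$F(D_n)=n-\sum_{1\le i\le r}\left\lfloor\frac{n}{p_i^{\acute{v}_{p_i}(n)}}\right\rfloor+\sum_{1\le i<j\le r}\left\lfloor\frac{n}{p_i^{\acute{v}_{p_i}(n)}p_j^{\acute{v}_{p_j}(n)}}\right\rfloor-\dots+(-1)^r\left\lfloor\frac{n}{\prod_{1\le i\le r}p_i^{\acute{v}_{p_i}(n)}}\right\rfloor.$$
   Context: All graphs are finite, simple and undirected. A graph $G$ with $n$ vertices is Diophantine if there is a bijection $f:V(G)\to\{1,\dots,n\}$ such that $\gcd(f(u),f(v))\mid n$ for every edge $uv$. A maximal Diophantine graph $D_n$ of order $n$ is a Diophantine graph of order $n$ such that adding any new edge yields a non-Diophantine graph. For a prime $p$, $v_p(n)$ is the $p$-adic valuation of $n$ and $\acute{v}_p(n):=v_p(n)+1$. $F(G)$ denotes the number of vertices of $G$ of degree $|V(G)|-1$ (full degree vertices). -}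

module Defs where

import Data.Nat
open import Data.Nat using (ℕ; zero; suc; _+_; _*_; _^_; _<_; _≤_)
open import Data.Nat.Properties using (_<?_; _≤?_)
open import Data.Nat.Divisibility using (_∣_; _∣?_; divides)
open import Data.Nat.GCD using (gcd)
open import Data.Nat.Primality using (Prime; prime?)
import Data.Integer as ℤ
open ℤ using (ℤ)
open import Data.Fin using (Fin; toℕ)
open import Data.Fin.Properties using () renaming (_≟_ to _≟F_)
open import Data.Bool using (Bool; true; false; _∧_; _∨_)
open import Data.List using (List; []; _∷_; length; filter; upTo; map; _++_; allFin)
open import Data.Nat.ListAction using (product)
open import Data.List using () renaming (all to allL)
open import Data.Product using (Σ; _×_; _,_)
open import Relation.Nullary using (¬_; yes; no; does)
open import Relation.Binary.PropositionalEquality using (_≡_)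
open import Function.Definitions using (Bijective)

record Graph (n : ℕ) : Set where
  field
    adj   : Fin n → Fin n → Bool
    sym   : ∀ u v → adj u v ≡ adj v u
    irref : ∀ u → adj u u ≡ false
open Graph public

label : ∀ {n} → (Fin n → Fin n) → Fin n → ℕ
label f v = suc (toℕ (f v))

Diophantine : ∀ {n} → Graph n → Set
Diophantine {n} G =
  Σ (Fin n → Fin n) λ f → Bijective _≡_ _≡_ f ×
    (∀ u v → adj G u v ≡ true → gcd (label f u) (label f v) ∣ n)

addEdge : ∀ {n} → Graph n → Fin n → Fin n → Graph n
addEdge {n} G a b = record { adj = A ; sym = S ; irref = I }
  where
  isab : Fin n → Fin n → Bool
  isab u v = (does (u ≟F a) ∧ does (v ≟F b)) ∨ (does (u ≟F b) ∧ does (v ≟F a))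
  A : Fin n → Fin n → Bool
  A u v with does (u ≟F v)
  ... | true  = false
  ... | false = adj G u v ∨ isab u v
  S : ∀ u v → A u v ≡ A v u
  S u v with u ≟F v | v ≟F u
  ... | yes _ | yes _ = Relation.Binary.PropositionalEquality.refl
  ... | yes p | no q = Data.Empty.⊥-elim (q (Relation.Binary.PropositionalEquality.sym p))
    where import Data.Empty
  ... | no q | yes p = Data.Empty.⊥-elim (q (Relation.Binary.PropositionalEquality.sym p))
    where import Data.Empty
  ... | no _ | no _ rewrite sym G u v with u ≟F a | v ≟F b | u ≟F b | v ≟F a
  ... | x1 | x2 | x3 | x4 with does x1 | does x2 | does x3 | does x4
  ... | b1 | b2 | b3 | b4 = lemma b1 b2 b3 b4 (adj G v u)
    where
    lemma : ∀ b1 b2 b3 b4 c → (c ∨ ((b1 ∧ b2) ∨ (b3 ∧ b4))) ≡ (c ∨ ((b4 ∧ b3) ∨ (b2 ∧ b1)))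
    lemma b1 b2 b3 b4 c = Relation.Binary.PropositionalEquality.cong (c ∨_)
      (Relation.Binary.PropositionalEquality.trans (BP.∨-comm (b1 ∧ b2) (b3 ∧ b4))
        (Relation.Binary.PropositionalEquality.cong₂ _∨_ (BP.∧-comm b3 b4) (BP.∧-comm b1 b2)))
      where import Data.Bool.Properties as BP
  I : ∀ u → A u u ≡ false
  I u with u ≟F u
  ... | yes _ = Relation.Binary.PropositionalEquality.refl
  ... | no q = Data.Empty.⊥-elim (q Relation.Binary.PropositionalEquality.refl)
    where import Data.Empty

MaximalDiophantine : ∀ {n} → Graph n → Set
MaximalDiophantine {n} G =
  Diophantine G ×
  (∀ u v → ¬ (u ≡ v) → adj G u v ≡ false → ¬ Diophantine (addEdge G u v))

isFull : ∀ {n} → Graph n → Fin n → Bool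
isFull {n} G u = allL (λ v → does (u ≟F v) ∨ adj G u v) (allFin n)

F : ∀ {n} → Graph n → ℕ
F {n} G = length (filter (λ u → isFull G u ≡? true) (allFin n))
  where
  open import Data.Bool.Properties using () renaming (_≟_ to _≡?_)

-- p-adic valuation v_p(n) (for p ≥ 2, n ≥ 1), computed with fuel
valF : ℕ → ℕ → ℕ → ℕ
valF zero     p m = 0
valF (suc k) p m with 2 ≤? p | 1 ≤? m | p ∣? m
... | yes _ | yes _ | yes (divides q _) = suc (valF k p q)
... | _     | _     | _                 = 0

v : ℕ → ℕ → ℕ
v p m = valF m p m

v' : ℕ → ℕ → ℕ
v' p m = v p m + 1

pp : ℕ → ℕ → ℕ
pp n p = p ^ v' p n

-- the distinct primes p with p^{v́_p(n)} < n/2, i.e. 2·p^{v́_p(n)} < n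
-- (such p are ≤ n, so listing candidates 0..n suffices)
qualPrimes : ℕ → List ℕ
qualPrimes n = filter (λ p → prime? p Relation.Nullary.×-dec (2 * pp n p <? n)) (upTo (suc n))
  where import Relation.Nullary

subsets : ∀ {A : Set} → List A → List (List A)
subsets []       = [] ∷ []
subsets (x ∷ xs) = subsets xs ++ map (x ∷_) (subsets xs)

sgn : ℕ → ℤ
sgn zero    = ℤ.+ 1
sgn (suc k) = ℤ.- sgn k

-- floor division (the divisor is never 0 where used; 0 case is a dummy)
_div_ : ℕ → ℕ → ℕ
m div zero    = 0
m div (suc k) = m Data.Nat./ suc k

IE : ℕ → ℤ
IE n = go (subsets (qualPrimes n))
  where
  term : List ℕ → ℤ
  term S = sgn (length S) ℤ.* ℤ.+ (n div product (map (pp n) S))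
  go : List (List ℕ) → ℤ
  go []       = ℤ.+ 0
  go (S ∷ Ss) = term S ℤ.+ go Ss

-- In a maximal Diophantine graph with labelling f, distinct vertices u and w are
-- adjacent exactly when gcd (f u) (f w) ∣ n: otherwise the edge uw could be added
-- with f still a Diophantine labelling. A number fails to divide n exactly when it is
-- divisible by some q = p ^ v́_p(n), and two distinct labels in 1..n that are
-- multiples of q force 2q ≤ n, where equality is impossible since q ∤ n. Conversely,
-- if such a q with 2q < n divides f u, one of q and 2q labels a vertex w ≠ u that
-- is not adjacent to u. So u has full degree iff f u is divisible by none of the
-- pairwise coprime moduli p ^ v́_p(n) with 2 p ^ v́_p(n) < n, and the labels 1..n
-- with this property are counted by inclusion–exclusion.
module Submission where

open import Defs hiding (sym)
open import Data.Nat using (ℕ; _≥_)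
open import Data.Integer using (ℤ; +_)
open import Relation.Binary.PropositionalEquality using (_≡_)

open import Algebra.Properties.CommutativeSemigroup using (interchange)
open import Data.Bool using (Bool; true; false; not; _∧_; _∨_; T)
open import Data.Bool.Properties using (T-≡) renaming (_≟_ to _≟ᵇ_)
open import Data.Empty using (⊥-elim)
open import Data.Fin using (Fin; toℕ; fromℕ<; fromℕ; inject₁; zero; suc)
open import Data.Fin.Properties
  using (toℕ-injective; toℕ-fromℕ<; toℕ<n; toℕ-inject₁; toℕ-fromℕ) renaming (_≟_ to _≟ᶠ_)
open import Data.Integer as ℤ using (-_; _-_)
import Data.Integer.Properties as ℤ
open import Data.List using (List; []; _∷_; map; length; upTo; allFin; filter; tabulate)
open import Data.List.Effectful.Foldable using (foldMap; ++-homo)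
open import Data.List.Membership.Propositional using (_∈_)
open import Data.List.Membership.Propositional.Properties
  using (∈-filter⁺; ∈-filter⁻; ∈-upTo⁺; ∈-allFin)
open import Data.List.Properties using (foldr-universal)
open import Data.List.Relation.Unary.All as All using (All; []; _∷_; all?)
open import Data.List.Relation.Unary.All.Properties using (all⁺; all⁻; tabulate⁺)
open import Data.List.Relation.Unary.AllPairs using (AllPairs; []; _∷_)
open import Data.List.Relation.Unary.Unique.Propositional using (Unique)
import Data.List.Relation.Unary.Unique.Propositional.Properties as Unique
open import Data.Nat hiding (_≟_)
open import Data.Nat.Coprimality as Coprime using (Coprime; coprime-divisor)
open import Data.Nat.Divisibility
  using (_∣_; _∣?_; divides; 1∣_; ∣-refl; ∣-reflexive; ∣-trans; n∣m*n; ∣n⇒∣m*n;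
         *-monoʳ-∣; *-cancelˡ-∣)
open import Data.Nat.DivMod
  using (_/_; _%_; 0/n≡0; n/1≡n; m*n/n≡m; m/n*n≤m; m*[n/m]≡n; m/n/o≡m/[n*o];
         m≡m%n+[m/n]*n; m%n<n; m<n*o⇒m/o<n; /-monoˡ-≤)
open import Data.Nat.GCD using (gcd; gcd-comm; gcd-greatest; gcd[m,n]∣m; gcd[m,n]∣n; gcd[m,n]≢0)
open import Data.Nat.ListAction using (product)
open import Data.Nat.Primality
  using (Prime; prime?; prime⇒irreducible; prime⇒nonZero; prime⇒nonTrivial; ¬prime[1])
open import Data.Nat.Primality.Factorisation using (factorise)
open import Data.Nat.Properties
open import Data.Product using (_,_; _×_; ∃-syntax; ∃₂; proj₁; proj₂)
open import Data.Sum using (_⊎_; inj₁; inj₂)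
open import Function using (_∘_; id; mk⇔; _⇔_; Equivalence; mk⤖)
open import Function.Definitions using (Bijective)
open import Function.Properties.Bijection using (⤖⇒↔)
open import Relation.Binary.PropositionalEquality
  using (_≢_; refl; sym; trans; cong; cong₂; subst; module ≡-Reasoning)
open import Relation.Nullary using (Dec; yes; no; does; ¬_; ¬?; _×-dec_)
open import Relation.Nullary.Decidable using (T?; does-⇔; decidable-stable)

open import Algebra.Properties.AbelianGroup ℤ.+-0-abelianGroup using (//-rightDividesʳ)
open import Algebra.Properties.CommutativeMonoid.Sum +-0-commutativeMonoid
  using (sum; sum-permute; sum-cong-≗; sum-init-last)

𝟙 : Bool → ℕ
𝟙 true  = 1
𝟙 false = 0

count : (ℕ → Bool) → ℕ → ℕ
count P zero    = 0
count P (suc N) = count P N + 𝟙 (P (suc N))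

count-cong : ∀ {P Q} → (∀ a → P a ≡ Q a) → ∀ N → count P N ≡ count Q N
count-cong P≗Q zero    = refl
count-cong P≗Q (suc N) = cong₂ _+_ (count-cong P≗Q N) (cong 𝟙 (P≗Q (suc N)))

count-true : ∀ N → count (λ _ → true) N ≡ N
count-true zero    = refl
count-true (suc N) = trans (cong (_+ 1) (count-true N)) (+-comm N 1)

count-split : ∀ (Q P : ℕ → Bool) N →
  count P N ≡ count (λ a → not (Q a) ∧ P a) N + count (λ a → Q a ∧ P a) N
count-split Q P zero    = refl
count-split Q P (suc N) =
  trans (cong₂ _+_ (count-split Q P N) (𝟙-split (Q (suc N)) (P (suc N))))
        (interchange +-commutativeSemigroup (count P₀ N) (count P₁ N) _ _)
  where
  P₀ P₁ : ℕ → Bool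
  P₀ a = not (Q a) ∧ P a
  P₁ a = Q a ∧ P a
  𝟙-split : ∀ q p → 𝟙 p ≡ 𝟙 (not q ∧ p) + 𝟙 (q ∧ p)
  𝟙-split false p = sym (+-identityʳ _)
  𝟙-split true  p = refl

/-unique : ∀ {m d q} .{{_ : NonZero d}} → q * d ≤ m → m < suc q * d → m / d ≡ q
/-unique {m} {d} {q} q*d≤m m<[1+q]*d = ≤-antisym
  (≤-pred (m<n*o⇒m/o<n m<[1+q]*d))
  (subst (_≤ m / d) (m*n/n≡m q d) (/-monoˡ-≤ d q*d≤m))

suc-/-∣ : ∀ {N d} .{{_ : NonZero d}} → d ∣ suc N → suc N / d ≡ suc (N / d)
suc-/-∣ {N} {d@(suc k)} (divides (suc q) 1+N≡[1+q]*d) = begin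
  suc N / d        ≡⟨ cong (_/ d) 1+N≡[1+q]*d ⟩
  suc q * d / d    ≡⟨ m*n/n≡m (suc q) d ⟩
  suc q            ≡⟨ cong suc (/-unique q*d≤N (≤-reflexive 1+N≡[1+q]*d)) ⟨
  suc (N / d)      ∎
  where
  open ≡-Reasoning
  q*d≤N : q * d ≤ N
  q*d≤N = subst (q * d ≤_) (sym (suc-injective 1+N≡[1+q]*d)) (m≤n+m (q * d) k)

suc-/-∤ : ∀ {N d} .{{_ : NonZero d}} → ¬ d ∣ suc N → suc N / d ≡ N / d
suc-/-∤ {N} {d} d∤1+N =
  /-unique (≤-trans (m/n*n≤m N d) (n≤1+n N)) (≤∧≢⇒< N<[1+q]*d 1+N≢[1+q]*d)
  where
  N<[1+q]*d : N < suc (N / d) * d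
  N<[1+q]*d = begin-strict
    N                  ≡⟨ m≡m%n+[m/n]*n N d ⟩
    N % d + N / d * d  <⟨ +-monoˡ-< (N / d * d) (m%n<n N d) ⟩
    suc (N / d) * d    ∎
    where open ≤-Reasoning
  1+N≢[1+q]*d : suc N ≢ suc (N / d) * d
  1+N≢[1+q]*d = d∤1+N ∘ divides (suc (N / d))

count-multiples-/ : ∀ d .{{_ : NonZero d}} (P : ℕ → Bool) N →
  count (λ a → does (d ∣? a) ∧ P a) N ≡ count (P ∘ (d *_)) (N / d)
count-multiples-/ d P zero = sym (cong (count (P ∘ (d *_))) (0/n≡0 d))
count-multiples-/ d P (suc N) with d ∣? suc N
... | no d∤1+N =
  trans (+-identityʳ _)
        (trans (count-multiples-/ d P N) (cong (count (P ∘ (d *_))) (sym (suc-/-∤ d∤1+N))))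
... | yes d∣1+N =
  trans (cong₂ _+_ (count-multiples-/ d P N) (cong (𝟙 ∘ P) 1+N≡d*[1+q]))
        (cong (count (P ∘ (d *_))) (sym (suc-/-∣ d∣1+N)))
  where
  1+N≡d*[1+q] : suc N ≡ d * suc (N / d)
  1+N≡d*[1+q] = trans (sym (m*[n/m]≡n d∣1+N)) (cong (d *_) (suc-/-∣ d∣1+N))

-- Also for d = 0: no positive number is a multiple of 0, and N div 0 = 0.
count-multiples : ∀ d (P : ℕ → Bool) N →
  count (λ a → does (d ∣? a) ∧ P a) N ≡ count (P ∘ (d *_)) (N div d)
count-multiples zero    P zero    = refl
count-multiples zero    P (suc N) = trans (+-identityʳ _) (count-multiples zero P N)
count-multiples (suc k) P N       = count-multiples-/ (suc k) P N

avoids : (ℕ → ℕ) → List ℕ → ℕ → Bool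
avoids g xs a = does (all? (λ x → ¬? (g x ∣? a)) xs)

avoids-* : ∀ {g d xs} → All (λ x → Coprime (g x) d) xs →
  ∀ b → avoids g xs (d * b) ≡ avoids g xs b
avoids-* {g} {d} {xs} g⊥d b = does-⇔ (mk⇔ to from) (all? _ xs) (all? _ xs)
  where
  to : All (λ x → ¬ g x ∣ d * b) xs → All (λ x → ¬ g x ∣ b) xs
  to = All.map (λ g∤db g∣b → g∤db (∣n⇒∣m*n d g∣b))
  from : All (λ x → ¬ g x ∣ b) xs → All (λ x → ¬ g x ∣ d * b) xs
  from g∤b = All.zipWith (λ (c , g∤b) g∣db → g∤b (coprime-divisor c g∣db)) (g⊥d , g∤b)

count-avoids-∷ : ∀ g x xs → All (λ y → Coprime (g y) (g x)) xs → ∀ N →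
  count (avoids g xs) N ≡ count (avoids g (x ∷ xs)) N + count (avoids g xs) (N div g x)
count-avoids-∷ g x xs xs⊥x N = begin
  count (avoids g xs) N
    ≡⟨ count-split (λ a → does (g x ∣? a)) (avoids g xs) N ⟩
  count (avoids g (x ∷ xs)) N + count (λ a → does (g x ∣? a) ∧ avoids g xs a) N
    ≡⟨ cong₂ _+_ refl (count-multiples (g x) (avoids g xs) N) ⟩
  count (avoids g (x ∷ xs)) N + count (avoids g xs ∘ (g x *_)) (N div g x)
    ≡⟨ cong₂ _+_ refl (count-cong (avoids-* xs⊥x) (N div g x)) ⟩
  count (avoids g (x ∷ xs)) N + count (avoids g xs) (N div g x)
    ∎
  where open ≡-Reasoning

signedTerm : (ℕ → ℕ) → ℕ → List ℕ → ℤ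
signedTerm g N S = sgn (length S) ℤ.* + (N div product (map g S))

inclusionExclusion : (ℕ → ℕ) → ℕ → List ℕ → ℤ
inclusionExclusion g N xs = foldMap ℤ.+-0-rawMonoid (signedTerm g N) (subsets xs)

-- The sum inside IE is a local function of Defs that cannot be named. Instantiating
-- foldr-universal before abstracting over subsets (qualPrimes n) lets unification
-- solve its argument h with that function.
IE≡inclusionExclusion : ∀ n → IE n ≡ inclusionExclusion (pp n) n (qualPrimes n)
IE≡inclusionExclusion n
  with foldr-universal _ (λ S acc → signedTerm (pp n) n S ℤ.+ acc) (+ 0) refl (λ _ _ → refl)
... | IE-sum≗foldr with subsets (qualPrimes n)
... | Ss = trans (IE-sum≗foldr Ss)
                 (sym (foldr-universal (foldMap ℤ.+-0-rawMonoid (signedTerm (pp n) n)) _ (+ 0)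
                                       refl (λ _ _ → refl) Ss))

div-* : ∀ m n o → m div (n * o) ≡ (m div n) div o
div-* m zero    zero    = refl
div-* m zero    (suc o) = refl
div-* m (suc n) zero    = cong (m div_) (*-zeroʳ n)
div-* m (suc n) (suc o) = sym (m/n/o≡m/[n*o] m (suc n) (suc o))

signedTerm-∷ : ∀ g N x S → signedTerm g N (x ∷ S) ≡ - signedTerm g (N div g x) S
signedTerm-∷ g N x S = begin
  - sgn (length S) ℤ.* + (N div (g x * product (map g S)))
    ≡⟨ cong (λ q → - sgn (length S) ℤ.* + q) (div-* N (g x) (product (map g S))) ⟩
  - sgn (length S) ℤ.* + ((N div g x) div product (map g S))
    ≡⟨ ℤ.neg-distribˡ-* (sgn (length S)) _ ⟨
  - signedTerm g (N div g x) S
    ∎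
  where open ≡-Reasoning

inclusionExclusion-∷ : ∀ g N x xs →
  inclusionExclusion g N (x ∷ xs) ≡ inclusionExclusion g N xs - inclusionExclusion g (N div g x) xs
inclusionExclusion-∷ g N x xs =
  trans (++-homo ℤ.+-0-monoid (signedTerm g N) (subsets xs))
        (cong (ℤ._+_ (inclusionExclusion g N xs)) (sum-over-∷ (subsets xs)))
  where
  sum-over-∷ : ∀ Ss → foldMap ℤ.+-0-rawMonoid (signedTerm g N) (map (x ∷_) Ss)
                    ≡ - foldMap ℤ.+-0-rawMonoid (signedTerm g (N div g x)) Ss
  sum-over-∷ []       = refl
  sum-over-∷ (S ∷ Ss) = trans (cong₂ ℤ._+_ (signedTerm-∷ g N x S) (sum-over-∷ Ss))
                              (sym (ℤ.neg-distrib-+ (signedTerm g (N div g x) S) _))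

count-avoids≡inclusionExclusion : ∀ g xs → AllPairs (λ x y → Coprime (g x) (g y)) xs →
  ∀ N → + count (avoids g xs) N ≡ inclusionExclusion g N xs
count-avoids≡inclusionExclusion g [] [] N = begin
  + count (λ _ → true) N     ≡⟨ cong +_ (count-true N) ⟩
  + N                        ≡⟨ cong +_ (n/1≡n N) ⟨
  + (N / 1)                  ≡⟨ ℤ.*-identityˡ _ ⟨
  + 1 ℤ.* + (N / 1)          ≡⟨ ℤ.+-identityʳ _ ⟨
  inclusionExclusion g N []  ∎
  where open ≡-Reasoning
count-avoids≡inclusionExclusion g (x ∷ xs) (x⊥xs ∷ xs-pairwise) N = begin
  + count (avoids g (x ∷ xs)) N
    ≡⟨ //-rightDividesʳ (+ c) (+ count (avoids g (x ∷ xs)) N) ⟨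
  (+ count (avoids g (x ∷ xs)) N ℤ.+ + c) - + c
    ≡⟨ cong (_- + c) (ℤ.pos-+ _ c) ⟨
  + (count (avoids g (x ∷ xs)) N + c) - + c
    ≡⟨ cong (λ a → + a - + c) (count-avoids-∷ g x xs (All.map Coprime.sym x⊥xs) N) ⟨
  + count (avoids g xs) N - + c
    ≡⟨ cong₂ _-_ (count-avoids≡inclusionExclusion g xs xs-pairwise N)
                 (count-avoids≡inclusionExclusion g xs xs-pairwise (N div g x)) ⟩
  inclusionExclusion g N xs - inclusionExclusion g (N div g x) xs
    ≡⟨ inclusionExclusion-∷ g N x xs ⟨
  inclusionExclusion g N (x ∷ xs)
    ∎
  where
  open ≡-Reasoning
  c = count (avoids g xs) (N div g x)

^-monoʳ-∣ : ∀ m {i j} → i ≤ j → m ^ i ∣ m ^ j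
^-monoʳ-∣ m z≤n       = 1∣ _
^-monoʳ-∣ m (s≤s i≤j) = *-monoʳ-∣ m (^-monoʳ-∣ m i≤j)

coprime-*ˡ : ∀ {m n o} → Coprime m o → Coprime n o → Coprime (m * n) o
coprime-*ˡ {m} m⊥o n⊥o {d} (d∣mn , d∣o) = n⊥o (coprime-divisor d⊥m d∣mn , d∣o)
  where
  d⊥m : Coprime d m
  d⊥m (e∣d , e∣m) = m⊥o (e∣m , ∣-trans e∣d d∣o)

coprime-^ˡ : ∀ {m o} → Coprime m o → ∀ k → Coprime (m ^ k) o
coprime-^ˡ {o = o} m⊥o zero    = Coprime.1-coprimeTo o
coprime-^ˡ         m⊥o (suc k) = coprime-*ˡ m⊥o (coprime-^ˡ m⊥o k)

prime∤⇒coprime : ∀ {p m} → Prime p → ¬ p ∣ m → Coprime p m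
prime∤⇒coprime p-prime p∤m (d∣p , d∣m) with prime⇒irreducible p-prime d∣p
... | inj₁ d≡1  = d≡1
... | inj₂ refl = ⊥-elim (p∤m d∣m)

distinct-primes-∤ : ∀ {p q} → Prime p → Prime q → p ≢ q → ¬ p ∣ q
distinct-primes-∤ p-prime q-prime p≢q p∣q with prime⇒irreducible q-prime p∣q
... | inj₁ refl = ¬prime[1] p-prime
... | inj₂ p≡q  = p≢q p≡q

prime-powers-coprime : ∀ {p q} → Prime p → Prime q → p ≢ q → ∀ i j → Coprime (p ^ i) (q ^ j)
prime-powers-coprime p-prime q-prime p≢q i j =
  Coprime.sym (coprime-^ˡ (Coprime.sym (coprime-^ˡ p⊥q i)) j)
  where p⊥q = prime∤⇒coprime p-prime (distinct-primes-∤ p-prime q-prime p≢q)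

product-∤⇒prime-power : ∀ {ps n} → All Prime ps → ¬ product ps ∣ n →
  ∃₂ λ p j → Prime p × p ^ j ∣ product ps × ¬ p ^ j ∣ n
product-∤⇒prime-power {[]}     {n} []              1∤n = ⊥-elim (1∤n (1∣ n))
product-∤⇒prime-power {p ∷ ps} {n} (p-prime ∷ prs) ∏∤n with p ∣? n
... | no p∤n =
  p , 1 , p-prime , *-monoʳ-∣ p (1∣ _) , p∤n ∘ ∣-trans (∣-reflexive (sym (*-identityʳ p)))
... | yes (divides n′ refl)
  with product-∤⇒prime-power prs (∏∤n ∘ subst (p * product ps ∣_) (*-comm p n′) ∘ *-monoʳ-∣ p)
...   | q , j , q-prime , q^j∣∏ , q^j∤n′ with q ≟ p
...     | yes refl =
  q , suc j , q-prime , *-monoʳ-∣ q q^j∣∏ ,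
  q^j∤n′ ∘ *-cancelˡ-∣ q {{prime⇒nonZero q-prime}} ∘ subst (q ^ suc j ∣_) (*-comm n′ q)
...     | no q≢p =
  q , j , q-prime , ∣n⇒∣m*n p q^j∣∏ ,
  q^j∤n′ ∘ coprime-divisor q^j⊥p ∘ subst (q ^ j ∣_) (*-comm n′ p)
  where
  q^j⊥p : Coprime (q ^ j) p
  q^j⊥p = coprime-^ˡ (prime∤⇒coprime q-prime (distinct-primes-∤ q-prime p-prime q≢p)) j

∤⇒prime-power : ∀ {d n} .{{_ : NonZero d}} → ¬ d ∣ n →
  ∃₂ λ p j → Prime p × p ^ j ∣ d × ¬ p ^ j ∣ n
∤⇒prime-power {d} d∤n with factorise d
... | record { factors = ps ; isFactorisation = refl ; factorsPrime = prs } =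
  product-∤⇒prime-power prs d∤n

valF-spec : ∀ k {p m} → 2 ≤ p → 0 < m → m ≤ k →
  p ^ valF k p m ∣ m × ¬ p ^ (valF k p m + 1) ∣ m
valF-spec zero    _   0<m m≤0 = ⊥-elim (<⇒≱ 0<m m≤0)
valF-spec (suc k) {p} {m} 2≤p 0<m m≤1+k with 2 ≤? p | 1 ≤? m | p ∣? m
... | no 2≰p | _      | _      = ⊥-elim (2≰p 2≤p)
... | yes _  | no 1≰m | _      = ⊥-elim (1≰m 0<m)
... | yes _  | yes _  | no p∤m = 1∣ m , p∤m ∘ ∣-trans (∣-reflexive (sym (*-identityʳ p)))
... | yes _  | yes _  | yes (divides q@(suc _) refl) =
  subst (p ^ suc j ∣_) (*-comm p q) (*-monoʳ-∣ p (proj₁ ih)) ,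
  proj₂ ih ∘ *-cancelˡ-∣ p ∘ subst (p ^ suc (j + 1) ∣_) (*-comm q p)
  where
  instance _ = >-nonZero (<-≤-trans z<s 2≤p)
  j = valF k p q
  ih : p ^ j ∣ q × ¬ p ^ (j + 1) ∣ q
  ih = valF-spec k 2≤p z<s (≤-pred (≤-trans (m<m*n q p 2≤p) m≤1+k))

prime⇒2≤ : ∀ {p} → Prime p → 2 ≤ p
prime⇒2≤ {p} p-prime = nonTrivial⇒n>1 p {{prime⇒nonTrivial p-prime}}

pp>0 : ∀ {n p} → Prime p → 0 < pp n p
pp>0 {n} {p} p-prime = m^n>0 p {{prime⇒nonZero p-prime}} (v p n + 1)

module _ {n} .{{_ : NonZero n}} {p} (p-prime : Prime p) where

  p^v∣n : p ^ v p n ∣ n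
  p^v∣n = proj₁ (valF-spec n (prime⇒2≤ p-prime) (>-nonZero⁻¹ n) ≤-refl)

  pp∤n : ¬ pp n p ∣ n
  pp∤n = proj₂ (valF-spec n (prime⇒2≤ p-prime) (>-nonZero⁻¹ n) ≤-refl)

  ∣∧∤⇒pp∣ : ∀ {j d} → p ^ j ∣ d → ¬ p ^ j ∣ n → pp n p ∣ d
  ∣∧∤⇒pp∣ {j} p^j∣d p^j∤n = ∣-trans (^-monoʳ-∣ p v+1≤j) p^j∣d
    where
    v+1≤j : v p n + 1 ≤ j
    v+1≤j = subst (_≤ j) (+-comm 1 (v p n))
              (≰⇒> (λ j≤v → p^j∤n (∣-trans (^-monoʳ-∣ p {j} j≤v) p^v∣n)))

∤⇒∃pp∣ : ∀ {n d} .{{_ : NonZero n}} .{{_ : NonZero d}} → ¬ d ∣ n → ∃[ p ] Prime p × pp n p ∣ d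
∤⇒∃pp∣ d∤n with ∤⇒prime-power d∤n
... | p , j , p-prime , p^j∣d , p^j∤n = p , p-prime , ∣∧∤⇒pp∣ p-prime {j} p^j∣d p^j∤n

qualPrime? : ∀ n p → Dec (Prime p × 2 * pp n p < n)
qualPrime? n p = prime? p ×-dec (2 * pp n p <? n)

∈-qualPrimes⁻ : ∀ {n p} → p ∈ qualPrimes n → Prime p × 2 * pp n p < n
∈-qualPrimes⁻ {n} p∈ = proj₂ (∈-filter⁻ (qualPrime? n) {xs = upTo (suc n)} p∈)

∈-qualPrimes⁺ : ∀ {n p} → Prime p → 2 * pp n p < n → p ∈ qualPrimes n
∈-qualPrimes⁺ {n} {p} p-prime 2pp<n =
  ∈-filter⁺ (qualPrime? n) (∈-upTo⁺ (s≤s p≤n)) (p-prime , 2pp<n)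
  where
  instance
    _ = prime⇒nonZero p-prime
    _ = m^n≢0 p (v p n)
  p≤n : p ≤ n
  p≤n = begin
    p              ≤⟨ m≤m*n p (p ^ v p n) ⟩
    p * p ^ v p n  ≡⟨ cong (p ^_) (+-comm (v p n) 1) ⟨
    pp n p         ≤⟨ m≤m+n (pp n p) _ ⟩
    2 * pp n p     <⟨ 2pp<n ⟩
    n              ∎
    where open ≤-Reasoning

distinct-primes⇒pairwise-coprime : ∀ (e : ℕ → ℕ) {ps} → All Prime ps → Unique ps →
  AllPairs (λ p q → Coprime (p ^ e p) (q ^ e q)) ps
distinct-primes⇒pairwise-coprime e []              []                = []
distinct-primes⇒pairwise-coprime e {p ∷ _} (p-prime ∷ prs) (p∉ps ∷ ps-distinct) =
  All.zipWith coprime-to-p (prs , p∉ps) ∷ distinct-primes⇒pairwise-coprime e prs ps-distinct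
  where
  coprime-to-p : ∀ {q} → Prime q × p ≢ q → Coprime (p ^ e p) (q ^ e q)
  coprime-to-p {q} (q-prime , p≢q) = prime-powers-coprime p-prime q-prime p≢q (e p) (e q)

qualPrimes-pairwise-coprime : ∀ n → AllPairs (λ p q → Coprime (pp n p) (pp n q)) (qualPrimes n)
qualPrimes-pairwise-coprime n = distinct-primes⇒pairwise-coprime (λ p → v p n + 1)
  (All.tabulate (proj₁ ∘ ∈-qualPrimes⁻ {n}))
  (Unique.filter⁺ (qualPrime? n) (Unique.upTo⁺ (suc n)))

∣∧≢⇒2*≤ : ∀ {q a} → q ∣ a → 0 < a → a ≢ q → 2 * q ≤ a
∣∧≢⇒2*≤ {q} (divides (suc (suc c)) refl) _  _   = *-monoˡ-≤ q {2} {suc (suc c)} (s≤s (s≤s z≤n))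
∣∧≢⇒2*≤ {q} (divides 1             refl) _  a≢q = ⊥-elim (a≢q (*-identityˡ q))
∣∧≢⇒2*≤     (divides 0             refl) () _

distinct-multiples⇒2*≤ : ∀ {q a b n} → q ∣ a → q ∣ b → 0 < a → 0 < b → a ≢ b →
  a ≤ n → b ≤ n → 2 * q ≤ n
distinct-multiples⇒2*≤ {q} {a} q∣a q∣b 0<a 0<b a≢b a≤n b≤n with a ≟ q
... | no  a≢q  = ≤-trans (∣∧≢⇒2*≤ q∣a 0<a a≢q) a≤n
... | yes refl = ≤-trans (∣∧≢⇒2*≤ q∣b 0<b (a≢b ∘ sym)) b≤n

∃multiple≢ : ∀ {q n} → 0 < q → 2 * q ≤ n → ∀ a → ∃[ m ] 0 < m × m ≤ n × m ≢ a × q ∣ m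
∃multiple≢ {q@(suc _)} _ 2q≤n a with q ≟ a
... | no  q≢a  = q , z<s , ≤-trans (m≤m+n q _) 2q≤n , q≢a , ∣-refl
... | yes refl = 2 * q , z<s , 2q≤n , m+1+n≢m q , n∣m*n 2

addEdge-adj⁻ : ∀ {n} (G : Graph n) a b u w → adj (addEdge G a b) u w ≡ true →
  adj G u w ≡ true ⊎ (u ≡ a × w ≡ b) ⊎ (u ≡ b × w ≡ a)
addEdge-adj⁻ G a b u w e with u ≟ᶠ w
addEdge-adj⁻ G a b u w () | yes _
... | no _ with adj G u w
...   | true  = inj₁ refl
...   | false with u ≟ᶠ a | w ≟ᶠ b | u ≟ᶠ b | w ≟ᶠ a
...     | yes u≡a | yes w≡b | _       | _       = inj₂ (inj₁ (u≡a , w≡b))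
...     | _       | _       | yes u≡b | yes w≡a = inj₂ (inj₂ (u≡b , w≡a))
addEdge-adj⁻ G a b u w () | no _ | false | no _  | _    | no _  | _
addEdge-adj⁻ G a b u w () | no _ | false | no _  | _    | yes _ | no _
addEdge-adj⁻ G a b u w () | no _ | false | yes _ | no _ | no _  | _
addEdge-adj⁻ G a b u w () | no _ | false | yes _ | no _ | yes _ | no _

isFull⇔adjacent : ∀ {n} {G : Graph n} {u} →
  T (isFull G u) ⇔ (∀ {w} → u ≢ w → adj G u w ≡ true)
isFull⇔adjacent {n} {G} {u} = mk⇔ to from
  where
  to : T (isFull G u) → ∀ {w} → u ≢ w → adj G u w ≡ true
  to full {w} u≢w with u ≟ᶠ w | All.lookup (all⁺ _ (allFin n) full) (∈-allFin w)
  ... | yes u≡w | _   = ⊥-elim (u≢w u≡w)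
  ... | no _    | u~w = Equivalence.to T-≡ u~w
  from : (∀ {w} → u ≢ w → adj G u w ≡ true) → T (isFull G u)
  from adjacent = all⁻ _ (tabulate⁺ equal-or-adjacent)
    where
    equal-or-adjacent : ∀ w → T (does (u ≟ᶠ w) ∨ adj G u w)
    equal-or-adjacent w with u ≟ᶠ w
    ... | yes _  = _
    ... | no u≢w = Equivalence.from T-≡ (adjacent u≢w)

module _ {n} {f : Fin n → Fin n} (f-bij : Bijective _≡_ _≡_ f) where

  label-injective : ∀ {u w} → label f u ≡ label f w → u ≡ w
  label-injective = proj₁ f-bij ∘ toℕ-injective ∘ suc-injective

  label-surjective : ∀ {m} → 0 < m → m ≤ n → ∃[ w ] label f w ≡ m
  label-surjective {suc m} _ m<n = w , cong suc (trans (cong toℕ fw≡k) (toℕ-fromℕ< m<n))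
    where
    k = fromℕ< m<n
    w = proj₁ (proj₂ f-bij k)
    fw≡k : f w ≡ k
    fw≡k = proj₂ (proj₂ f-bij k) refl

length-filter-tabulate : ∀ {A : Set} {n} (Q : A → Bool) (h : Fin n → A) →
  length (filter (λ x → Q x ≟ᵇ true) (tabulate h)) ≡ sum (𝟙 ∘ Q ∘ h)
length-filter-tabulate {n = zero}  Q h = refl
length-filter-tabulate {n = suc n} Q h with Q (h zero)
... | true  = cong suc (length-filter-tabulate Q (h ∘ suc))
... | false = length-filter-tabulate Q (h ∘ suc)

sum-count : ∀ (P : ℕ → Bool) N → sum (𝟙 ∘ P ∘ suc ∘ toℕ {N}) ≡ count P N
sum-count P zero    = refl
sum-count P (suc N) = begin
  sum (𝟙 ∘ P ∘ suc ∘ toℕ {suc N})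
    ≡⟨ sum-init-last (𝟙 ∘ P ∘ suc ∘ toℕ) ⟩
  sum (𝟙 ∘ P ∘ suc ∘ toℕ ∘ inject₁ {N}) + 𝟙 (P (suc (toℕ (fromℕ N))))
    ≡⟨ cong₂ _+_ (sum-cong-≗ {N} (cong (𝟙 ∘ P ∘ suc) ∘ toℕ-inject₁))
                 (cong (𝟙 ∘ P ∘ suc) (toℕ-fromℕ N)) ⟩
  sum (𝟙 ∘ P ∘ suc ∘ toℕ {N}) + 𝟙 (P (suc N))
    ≡⟨ cong (_+ 𝟙 (P (suc N))) (sum-count P N) ⟩
  count P (suc N)
    ∎
  where open ≡-Reasoning

F≡count : ∀ {n} {G : Graph n} {f} (P : ℕ → Bool) → Bijective _≡_ _≡_ f →
  (∀ u → isFull G u ≡ P (label f u)) → F G ≡ count P n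
F≡count {n} {G} {f} P f-bij isFull≡P = begin
  F G                          ≡⟨ length-filter-tabulate (isFull G) id ⟩
  sum (𝟙 ∘ isFull G)           ≡⟨ sum-cong-≗ (cong 𝟙 ∘ isFull≡P) ⟩
  sum (𝟙 ∘ P ∘ label f)        ≡⟨ sum-permute (𝟙 ∘ P ∘ suc ∘ toℕ) (⤖⇒↔ (mk⤖ f-bij)) ⟨
  sum (𝟙 ∘ P ∘ suc ∘ toℕ {n})  ≡⟨ sum-count P n ⟩
  count P n                    ∎
  where open ≡-Reasoning

module MaximalDiophantineLabelling {n} {G : Graph n} {f : Fin n → Fin n}
  (f-bij : Bijective _≡_ _≡_ f)
  (f-gcd : ∀ u w → adj G u w ≡ true → gcd (label f u) (label f w) ∣ n)
  (maximal : ∀ u w → u ≢ w → adj G u w ≡ false → ¬ Diophantine (addEdge G u w))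
  where

  gcd∣n⇒adj : ∀ {u w} → u ≢ w → gcd (label f u) (label f w) ∣ n → adj G u w ≡ true
  gcd∣n⇒adj {u} {w} u≢w gcd∣n with adj G u w in u≁w
  ... | true  = refl
  ... | false = ⊥-elim (maximal u w u≢w u≁w (f , f-bij , f-gcd⁺))
    where
    f-gcd⁺ : ∀ x y → adj (addEdge G u w) x y ≡ true → gcd (label f x) (label f y) ∣ n
    f-gcd⁺ x y x~⁺y with addEdge-adj⁻ G u w x y x~⁺y
    ... | inj₁ x~y                  = f-gcd x y x~y
    ... | inj₂ (inj₁ (refl , refl)) = gcd∣n
    ... | inj₂ (inj₂ (refl , refl)) = subst (_∣ n) (gcd-comm (label f y) (label f x)) gcd∣n

  module _ .{{_ : NonZero n}} where

    pp∣label⇒¬full : ∀ {u p} → p ∈ qualPrimes n → pp n p ∣ label f u → ¬ T (isFull G u)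
    pp∣label⇒¬full {u} {p} p∈ pp∣fu full with ∈-qualPrimes⁻ p∈
    ... | p-prime , 2pp<n with ∃multiple≢ (pp>0 {n} p-prime) (<⇒≤ 2pp<n) (label f u)
    ... | m , 0<m , m≤n , m≢fu , pp∣m with label-surjective f-bij 0<m m≤n
    ... | w , refl = pp∤n {n} p-prime (∣-trans (gcd-greatest pp∣fu pp∣m) (f-gcd u w u~w))
      where
      u≢w : u ≢ w
      u≢w refl = m≢fu refl
      u~w : adj G u w ≡ true
      u~w = Equivalence.to (isFull⇔adjacent {G = G}) full u≢w

    gcd∤n⇒∃pp∣label : ∀ {u w} → u ≢ w → ¬ gcd (label f u) (label f w) ∣ n →
      ∃[ p ] p ∈ qualPrimes n × pp n p ∣ label f u
    gcd∤n⇒∃pp∣label {u} {w} u≢w gcd∤n with ∤⇒∃pp∣ {n} gcd∤n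
      where
      instance
        gcd≢0 : NonZero (gcd (label f u) (label f w))
        gcd≢0 = ≢-nonZero (gcd[m,n]≢0 (label f u) (label f w) (inj₁ λ ()))
    ... | p , p-prime , pp∣gcd = p , ∈-qualPrimes⁺ p-prime 2pp<n , pp∣fu
      where
      pp∣fu : pp n p ∣ label f u
      pp∣fu = ∣-trans pp∣gcd (gcd[m,n]∣m (label f u) (label f w))
      pp∣fw : pp n p ∣ label f w
      pp∣fw = ∣-trans pp∣gcd (gcd[m,n]∣n (label f u) (label f w))
      2pp≤n : 2 * pp n p ≤ n
      2pp≤n = distinct-multiples⇒2*≤ pp∣fu pp∣fw z<s z<s (u≢w ∘ label-injective f-bij)
                                      (toℕ<n (f u)) (toℕ<n (f w))
      2pp<n : 2 * pp n p < n
      2pp<n = ≤∧≢⇒< 2pp≤n (λ 2pp≡n → pp∤n {n} p-prime (subst (pp n p ∣_) 2pp≡n (n∣m*n 2)))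

    isFull⇔avoids : ∀ {u} → T (isFull G u) ⇔ All (λ p → ¬ pp n p ∣ label f u) (qualPrimes n)
    isFull⇔avoids {u} = mk⇔
      (λ full → All.tabulate λ p∈ pp∣fu → pp∣label⇒¬full p∈ pp∣fu full)
      (λ avoid → Equivalence.from (isFull⇔adjacent {G = G}) λ {w} u≢w → gcd∣n⇒adj u≢w
        (decidable-stable (gcd (label f u) (label f w) ∣? n) λ gcd∤n →
          let p , p∈ , pp∣fu = gcd∤n⇒∃pp∣label u≢w gcd∤n in All.lookup avoid p∈ pp∣fu))

    F≡count-avoids : F G ≡ count (avoids (pp n) (qualPrimes n)) n
    F≡count-avoids = F≡count {G = G} (avoids (pp n) (qualPrimes n)) f-bij λ u →
      does-⇔ isFull⇔avoids (T? (isFull G u)) (all? _ (qualPrimes n))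

theorem3p1 : (n : ℕ) → n ≥ 1 → (G : Graph n) → MaximalDiophantine G →
    + F G ≡ IE n
theorem3p1 n n≥1 G ((f , f-bij , f-gcd) , maximal) = begin
  + F G
    ≡⟨ cong +_ F≡count-avoids ⟩
  + count (avoids (pp n) (qualPrimes n)) n
    ≡⟨ count-avoids≡inclusionExclusion (pp n) (qualPrimes n) (qualPrimes-pairwise-coprime n) n ⟩
  inclusionExclusion (pp n) n (qualPrimes n)
    ≡⟨ IE≡inclusionExclusion n ⟨
  IE n
    ∎
  where
  open ≡-Reasoning
  open MaximalDiophantineLabelling f-bij f-gcd maximal
  instance _ = >-nonZero n≥1
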